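{- Let $B=[b_{1,1},\dots,b_{1,k}]$ be a $1\times k$ integer matrix for some positive integer $k$, with $\ker(B)\cap\mathbb{R}^k_{\ge0}=\{\mathbf{0}\}$. Then $p_B$ is a polynomial of degree $k-1$ on $\mathcal{S}(B)$ if and only if all $k$ entries of $B$ are equal to a common non-zero integer $\beta$. In this case $p_B(b)=\binom{\frac{b}{\beta}+k-1}{k-1}$ for all $b\in\mathcal{S}(B)$.
   Context: $p_B(b)=\#\{\mathbf{x}\in\mathbb{N}^k: B\mathbf{x}=b\}$ for $b\in\mathbb{Z}$, and $\mathcal{S}(B)=\{\sum_i\lambda_i b_{1,i}:\lambda_i\in\mathbb{N}\}$.
   Formalization: The polynomial of degree k−1 that agrees with $p_B$ on $\mathcal{S}(B)$ is taken with rational coefficients. -}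

module Defs where

open import Data.Nat as ℕ using (ℕ; zero; suc)
open import Data.Integer as ℤ using (ℤ; +_)
open import Data.Rational as ℚ using (ℚ; 0ℚ; 1ℚ)
open import Data.Vec using (Vec; []; _∷_; last)
open import Data.Vec.Relation.Unary.All using (All)
open import Data.Product using (Σ; ∃; _×_)
open import Data.Fin using (Fin)
open import Function.Bundles using (_↔_)
open import Relation.Binary.PropositionalEquality using (_≡_; _≢_)

toℚ : ℤ → ℚ
toℚ z = z ℚ./ 1

dotℕ : ∀ {k} → Vec ℤ k → Vec ℕ k → ℤ
dotℕ [] [] = + 0
dotℕ (b ∷ bs) (x ∷ xs) = b ℤ.* (+ x) ℤ.+ dotℕ bs xs

dotℚ : ∀ {k} → Vec ℤ k → Vec ℚ k → ℚ
dotℚ [] [] = 0ℚ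
dotℚ (b ∷ bs) (x ∷ xs) = toℚ b ℚ.* x ℚ.+ dotℚ bs xs

-- ker(B) ∩ (nonnegative orthant) = {0}   (taken over ℚ)
PointedKernel : ∀ {k} → Vec ℤ k → Set
PointedKernel {k} B =
  (x : Vec ℚ k) → All (0ℚ ℚ.≤_) x → dotℚ B x ≡ 0ℚ → All (_≡ 0ℚ) x

Sol : ∀ {k} → Vec ℤ k → ℤ → Set
Sol {k} B b = Σ (Vec ℕ k) (λ x → dotℕ B x ≡ b)

-- p_B(b) = n : the solution set has exactly n elements
HasCount : ∀ {k} → Vec ℤ k → ℤ → ℕ → Set
HasCount B b n = Fin n ↔ Sol B b

InS : ∀ {k} → Vec ℤ k → ℤ → Set
InS {k} B b = ∃ λ (lam : Vec ℕ k) → dotℕ B lam ≡ b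

-- polynomial evaluation (Horner): cs = [c₀, c₁, …, c_d] ↦ Σ cᵢ xⁱ
evalPoly : ∀ {n} → Vec ℚ n → ℚ → ℚ
evalPoly [] x = 0ℚ
evalPoly (c ∷ cs) x = c ℚ.+ x ℚ.* evalPoly cs x

IsPolyOfDegreeOnS : ∀ {k} → Vec ℤ k → ℕ → Set
IsPolyOfDegreeOnS B d =
  Σ (Vec ℚ (suc d)) λ cs →
    (last cs ≢ 0ℚ) ×
    (∀ b → InS B b → ∃ λ n → HasCount B b n × evalPoly cs (toℚ b) ≡ toℚ (+ n))

{-# OPTIONS --safe #-}
module Submission where

-- If p_B agrees on S(B) with a polynomial of degree m = k − 1, take finite differences
-- along all entries of B but one, bᵢ. Differencing along an entry d deletes it, since
-- p_{d∷R}(c + d) − p_{d∷R}(c) = p_R(c + d). After m steps the number of solutions of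
-- bᵢ x = c + s is the constant m! (∏ d) (leading coefficient) ≠ 0 for all c ∈ S(B), so bᵢ
-- divides c + s there, hence divides every entry. Thus the entries agree up to sign, and
-- a pointed kernel rules out bᵢ + bⱼ = 0. Conversely, if every entry is β, the solutions
-- of B x = βq are the compositions of q into k parts, counted by
-- C(q + m, m) = ∏_{1 ≤ i ≤ m} (1 + βq / (β i)), a polynomial of degree m in b = βq.

open import Defs
open import Data.Nat using (ℕ; suc; _+_)
open import Data.Nat.Combinatorics using (_C_)
open import Data.Integer using (ℤ; +_; _*_)
open import Data.Vec using (Vec)
open import Data.Vec.Relation.Unary.All using (All)
open import Data.Product using (∃; _×_)
open import Function.Bundles using (_⇔_)
open import Relation.Binary.PropositionalEquality using (_≡_; _≢_)

import Axiom.UniquenessOfIdentityProofs as UIP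
open import Data.Empty using (⊥-elim)
open import Data.Fin using (Fin; zero; suc)
open import Data.Fin.Permutation using (↔⇒≡)
open import Data.Fin.Properties using (+↔⊎)
open import Data.Integer as ℤ using (0ℤ; -[1+_])
open import Data.Integer.Divisibility.Signed using (_∣_; divides; _∣?_; ∣m+n∣n⇒∣m; ∣⇒∣ᵤ)
import Data.Integer.Properties as ℤP
open import Algebra.Properties.AbelianGroup ℤP.+-0-abelianGroup using ()
  renaming (∙-cancelʳ to +-cancelʳ)
open import Data.Integer.Tactic.RingSolver using (solve-∀)
open import Data.Nat as ℕ using (zero; _!)
open import Data.Nat.Combinatorics
  using (nCn≡1; nCk+nC[k+1]≡[n+1]C[k+1]; nCk≡n!/k![n-k]!; k![n∸k]!∣n!)
open import Data.Nat.Coprimality using (1-coprimeTo) renaming (sym to coprime-sym)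
import Data.Nat.Divisibility as ℕD
open import Data.Nat.DivMod using (m/n*n≡m)
import Data.Nat.Properties as ℕP
open import Data.Nat.Tactic.RingSolver using () renaming (solve-∀ to ℕ-solve-∀)
open import Data.Product using (_,_; proj₁; proj₂)
open import Data.Rational as ℚ using (ℚ; 0ℚ; 1ℚ; mkℚ)
import Data.Rational.Properties as ℚP
open import Data.Rational.Solver using (module +-*-Solver)
open import Data.Sum using (_⊎_; inj₁; inj₂)
open import Data.Sum.Algebra using (⊎-cong; ⊎-comm)
open import Data.Vec using ([]; _∷_; last; lookup; replicate; zipWith; sum)
open import Data.Vec.Relation.Unary.All using ([]; _∷_)
import Data.Vec.Relation.Unary.All as All
open import Data.Vec.Relation.Unary.All.Properties using (lookup⁻)
open import Function.Bundles using (_↔_; mk↔ₛ′; mk⇔)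
open import Function.Properties.Inverse using (↔-refl; ↔-sym; ↔-trans)
open import Relation.Nullary using (¬_; yes; no)
open import Relation.Binary.PropositionalEquality
  using (refl; sym; trans; cong; cong₂; subst; subst₂; module ≡-Reasoning)

open +-*-Solver

-- `z / 1` is already in lowest terms, so toℚ z is the raw fraction z/1,
-- on which ℚ's + and * reduce to integer arithmetic.
toℚ≡mkℚ : ∀ z → toℚ z ≡ mkℚ z 0 (coprime-sym (1-coprimeTo ℤ.∣ z ∣))
toℚ≡mkℚ z = ℚP.↥p/↧p≡p _

toℚ-+ : ∀ a b → toℚ (a ℤ.+ b) ≡ toℚ a ℚ.+ toℚ b
toℚ-+ a b rewrite toℚ≡mkℚ a | toℚ≡mkℚ b =
  cong (ℚ._/ 1) (sym (cong₂ ℤ._+_ (ℤP.*-identityʳ a) (ℤP.*-identityʳ b)))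

toℚ-* : ∀ a b → toℚ (a ℤ.* b) ≡ toℚ a ℚ.* toℚ b
toℚ-* a b rewrite toℚ≡mkℚ a | toℚ≡mkℚ b = refl

toℚ-injective : ∀ {a b} → toℚ a ≡ toℚ b → a ≡ b
toℚ-injective {a} {b} eq rewrite toℚ≡mkℚ a | toℚ≡mkℚ b = cong ℚ.↥_ eq

toℚ≢0 : ∀ {z} → z ≢ 0ℤ → toℚ z ≢ 0ℚ
toℚ≢0 z≢0 eq = z≢0 (toℚ-injective eq)

toℚ₊ : ℕ → ℚ
toℚ₊ n = toℚ (+ n)

toℚ₊-+ : ∀ m n → toℚ₊ (m ℕ.+ n) ≡ toℚ₊ m ℚ.+ toℚ₊ n
toℚ₊-+ m n = toℚ-+ (+ m) (+ n)

toℚ₊-* : ∀ m n → toℚ₊ (m ℕ.* n) ≡ toℚ₊ m ℚ.* toℚ₊ n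
toℚ₊-* m n = trans (cong toℚ (ℤP.pos-* m n)) (toℚ-* (+ m) (+ n))

toℚ₊-suc≢0 : ∀ n → toℚ₊ (suc n) ≢ 0ℚ
toℚ₊-suc≢0 n = toℚ≢0 {+ suc n} λ ()

p*q≡1⇒p≢0 : ∀ {p q} → p ℚ.* q ≡ 1ℚ → p ≢ 0ℚ
p*q≡1⇒p≢0 {q = q} pq≡1 refl = ℚP.1≢0 (trans (sym pq≡1) (ℚP.*-zeroˡ q))

p*q≢0 : ∀ {p q} → p ≢ 0ℚ → q ≢ 0ℚ → p ℚ.* q ≢ 0ℚ
p*q≢0 {p} {q} p≢0 q≢0 pq≡0 = p≢0 (begin
  p                    ≡⟨ sym (ℚP.*-identityʳ p) ⟩
  p ℚ.* 1ℚ             ≡⟨ cong (p ℚ.*_) (sym (ℚP.*-inverseʳ q)) ⟩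
  p ℚ.* (q ℚ.* ℚ.1/ q) ≡⟨ sym (ℚP.*-assoc p q _) ⟩
  p ℚ.* q ℚ.* ℚ.1/ q   ≡⟨ cong (ℚ._* ℚ.1/ q) pq≡0 ⟩
  0ℚ ℚ.* ℚ.1/ q        ≡⟨ ℚP.*-zeroˡ (ℚ.1/ q) ⟩
  0ℚ                   ∎)
  where
  open ≡-Reasoning
  instance _ = ℚ.≢-nonZero q≢0

Δ : ℚ → (ℚ → ℚ) → ℚ → ℚ
Δ d f x = f (x ℚ.+ d) ℚ.- f x

-- Every n-fold difference Δ d₁ (⋯ (Δ dₙ f)) is the constant n! d₁ ⋯ dₙ L:
-- f behaves like a polynomial of degree at most n with coefficient L at xⁿ.
HasLeading : ℕ → (ℚ → ℚ) → ℚ → Set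
HasLeading zero    f L = ∀ x → f x ≡ L
HasLeading (suc n) f L = ∀ d → HasLeading n (Δ d f) (toℚ₊ (suc n) ℚ.* d ℚ.* L)

HasLeading-ext : ∀ n {f g L} → (∀ x → f x ≡ g x) → HasLeading n f L → HasLeading n g L
HasLeading-ext zero    f≗g hf x = trans (sym (f≗g x)) (hf x)
HasLeading-ext (suc n) f≗g hf d =
  HasLeading-ext n (λ x → cong₂ ℚ._-_ (f≗g (x ℚ.+ d)) (f≗g x)) (hf d)

HasLeading-+ : ∀ n {f g L K} → HasLeading n f L → HasLeading n g K →
               HasLeading n (λ x → f x ℚ.+ g x) (L ℚ.+ K)
HasLeading-+ zero    hf hg x = cong₂ ℚ._+_ (hf x) (hg x)
HasLeading-+ (suc n) {f} {g} {L} {K} hf hg d =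
  HasLeading-ext n
    (λ x → solve 4 (λ a b c e → (a :- b) :+ (c :- e) := (a :+ c) :- (b :+ e)) refl
                   (f (x ℚ.+ d)) (f x) (g (x ℚ.+ d)) (g x))
    (subst (HasLeading n _)
      (solve 4 (λ a b c e → a :* b :* c :+ a :* b :* e := a :* b :* (c :+ e)) refl
             (toℚ₊ (suc n)) d L K)
      (HasLeading-+ n (hf d) (hg d)))

HasLeading-*ˡ : ∀ n {f L} k → HasLeading n f L → HasLeading n (λ x → k ℚ.* f x) (k ℚ.* L)
HasLeading-*ˡ zero    k hf x = cong (k ℚ.*_) (hf x)
HasLeading-*ˡ (suc n) {f} {L} k hf d =
  HasLeading-ext n
    (λ x → solve 3 (λ k a b → k :* (a :- b) := k :* a :- k :* b) refl k (f (x ℚ.+ d)) (f x))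
    (subst (HasLeading n _)
      (solve 4 (λ k a b c → k :* (a :* b :* c) := a :* b :* (k :* c)) refl k (toℚ₊ (suc n)) d L)
      (HasLeading-*ˡ n k (hf d)))

HasLeading-shift : ∀ n {f L} a → HasLeading n f L → HasLeading n (λ x → f (x ℚ.+ a)) L
HasLeading-shift zero    a hf x = hf (x ℚ.+ a)
HasLeading-shift (suc n) {f} a hf d =
  HasLeading-ext n
    (λ x → cong (λ y → f y ℚ.- f (x ℚ.+ a))
                (solve 3 (λ x a d → (x :+ a) :+ d := (x :+ d) :+ a) refl x a d))
    (HasLeading-shift n a (hf d))

HasLeading-zero : ∀ n → HasLeading n (λ _ → 0ℚ) 0ℚ
HasLeading-zero zero    x = refl
HasLeading-zero (suc n) d =
  HasLeading-ext n (λ _ → sym (ℚP.+-inverseʳ 0ℚ))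
    (subst (HasLeading n _) (sym (ℚP.*-zeroʳ (toℚ₊ (suc n) ℚ.* d))) (HasLeading-zero n))

HasLeading-const : ∀ n c → HasLeading (suc n) (λ _ → c) 0ℚ
HasLeading-const n c d =
  HasLeading-ext n (λ _ → sym (ℚP.+-inverseʳ c))
    (subst (HasLeading n _) (sym (ℚP.*-zeroʳ (toℚ₊ (suc n) ℚ.* d))) (HasLeading-zero n))

-- Product rule: Δ d (x ↦ x g x) x = x Δ d g x + d g (x + d).
HasLeading-x* : ∀ n {g L} → HasLeading n g L → HasLeading (suc n) (λ x → x ℚ.* g x) L
HasLeading-x* zero {g} {L} hg d x = begin
  (x ℚ.+ d) ℚ.* g (x ℚ.+ d) ℚ.- x ℚ.* g x
    ≡⟨ cong₂ (λ u v → (x ℚ.+ d) ℚ.* u ℚ.- x ℚ.* v) (hg (x ℚ.+ d)) (hg x) ⟩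
  (x ℚ.+ d) ℚ.* L ℚ.- x ℚ.* L
    ≡⟨ solve 3 (λ x d L → (x :+ d) :* L :- x :* L := con 1ℚ :* d :* L) refl x d L ⟩
  1ℚ ℚ.* d ℚ.* L ∎
  where open ≡-Reasoning
HasLeading-x* (suc n) {g} {L} hg d =
  HasLeading-ext (suc n) {split}
    (λ x → solve 4 (λ x d a b → x :* (a :- b) :+ d :* a := (x :+ d) :* a :- x :* b) refl
                   x d (g (x ℚ.+ d)) (g x))
    (subst (HasLeading (suc n) split) leading
      (HasLeading-+ (suc n) {λ x → x ℚ.* Δ d g x} {λ x → d ℚ.* g (x ℚ.+ d)}
        (HasLeading-x* n {Δ d g} (hg d))
        (HasLeading-*ˡ (suc n) d (HasLeading-shift (suc n) {g} d hg))))
  where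
  split : ℚ → ℚ
  split x = x ℚ.* Δ d g x ℚ.+ d ℚ.* g (x ℚ.+ d)
  leading : toℚ₊ (suc n) ℚ.* d ℚ.* L ℚ.+ d ℚ.* L ≡ toℚ₊ (suc (suc n)) ℚ.* d ℚ.* L
  leading rewrite toℚ₊-+ 1 (suc n) =
    solve 3 (λ a d L → a :* d :* L :+ d :* L := (con 1ℚ :+ a) :* d :* L) refl (toℚ₊ (suc n)) d L

HasLeading-evalPoly : ∀ n (cs : Vec ℚ (suc n)) → HasLeading n (evalPoly cs) (last cs)
HasLeading-evalPoly zero    (c ∷ []) x = solve 2 (λ c x → c :+ x :* con 0ℚ := c) refl c x
HasLeading-evalPoly (suc n) (c ∷ cs) =
  subst (HasLeading (suc n) (evalPoly (c ∷ cs))) (ℚP.+-identityˡ (last cs))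
    (HasLeading-+ (suc n) {λ _ → c} {λ x → x ℚ.* evalPoly cs x} (HasLeading-const n c)
      (HasLeading-x* n {evalPoly cs} (HasLeading-evalPoly n cs)))

All-drop-second : ∀ {A : Set} {P : A → Set} {k x y} {xs : Vec A k} →
                  All P (x ∷ y ∷ xs) → All P (x ∷ xs)
All-drop-second (px ∷ _ ∷ pxs) = px ∷ pxs

¬⇒⊎-identityˡ : {A B : Set} → ¬ A → (A ⊎ B) ↔ B
¬⇒⊎-identityˡ {A} {B} ¬a = mk↔ₛ′ to inj₂ (λ _ → refl) from∘to
  where
  to : A ⊎ B → B
  to (inj₁ a) = ⊥-elim (¬a a)
  to (inj₂ b) = b
  from∘to : ∀ x → inj₂ (to x) ≡ x
  from∘to (inj₁ a) = ⊥-elim (¬a a)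
  from∘to (inj₂ b) = refl

¬⇒⊎-identityʳ : {A B : Set} → ¬ B → (A ⊎ B) ↔ A
¬⇒⊎-identityʳ ¬b = ↔-trans (⊎-comm _ _) (¬⇒⊎-identityˡ ¬b)

⊎-shuffle : {X Y F G : Set} → (Y ⊎ (X ⊎ G) ⊎ F) ↔ (((X ⊎ Y) ⊎ F) ⊎ G)
⊎-shuffle {X} {Y} {F} {G} = mk↔ₛ′ to from to∘from from∘to
  where
  to : Y ⊎ (X ⊎ G) ⊎ F → ((X ⊎ Y) ⊎ F) ⊎ G
  to (inj₁ y)               = inj₁ (inj₁ (inj₂ y))
  to (inj₂ (inj₁ (inj₁ x))) = inj₁ (inj₁ (inj₁ x))
  to (inj₂ (inj₁ (inj₂ g))) = inj₂ g
  to (inj₂ (inj₂ f))        = inj₁ (inj₂ f)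
  from : ((X ⊎ Y) ⊎ F) ⊎ G → Y ⊎ (X ⊎ G) ⊎ F
  from (inj₁ (inj₁ (inj₁ x))) = inj₂ (inj₁ (inj₁ x))
  from (inj₁ (inj₁ (inj₂ y))) = inj₁ y
  from (inj₁ (inj₂ f))        = inj₂ (inj₂ f)
  from (inj₂ g)               = inj₂ (inj₁ (inj₂ g))
  to∘from : ∀ z → to (from z) ≡ z
  to∘from (inj₁ (inj₁ (inj₁ x))) = refl
  to∘from (inj₁ (inj₁ (inj₂ y))) = refl
  to∘from (inj₁ (inj₂ f))        = refl
  to∘from (inj₂ g)               = refl
  from∘to : ∀ z → from (to z) ≡ z
  from∘to (inj₁ y)               = refl
  from∘to (inj₂ (inj₁ (inj₁ x))) = refl
  from∘to (inj₂ (inj₁ (inj₂ g))) = refl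
  from∘to (inj₂ (inj₂ f))        = refl

-- X ⊎ Fin padding ↔ Fin size says that X has "size − padding" elements. Such virtual
-- counts can be subtracted (virtualCount-split) without cancelling Fin summands.
record VirtualCount (X : Set) (z : ℚ) : Set where
  constructor virtualCount
  field
    padding size : ℕ
    iso          : (X ⊎ Fin padding) ↔ Fin size
    value        : toℚ₊ size ℚ.- toℚ₊ padding ≡ z

count⇒virtualCount : ∀ {X n} → Fin n ↔ X → VirtualCount X (toℚ₊ n)
count⇒virtualCount {n = n} Fin-n↔X =
  virtualCount 0 n (↔-trans (¬⇒⊎-identityʳ λ ()) (↔-sym Fin-n↔X)) (ℚP.+-identityʳ (toℚ₊ n))

virtualCount-split : ∀ {X Y Z a b} → Z ↔ (X ⊎ Y) →
                     VirtualCount Z a → VirtualCount X b → VirtualCount Y (a ℚ.- b)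
virtualCount-split {a = a} {b} Z↔X⊎Y (virtualCount M₁ M₁′ I₁ v₁) (virtualCount M₂ M₂′ I₂ v₂) =
  virtualCount (M₂′ ℕ.+ M₁) (M₁′ ℕ.+ M₂)
    (↔-trans (⊎-cong ↔-refl (↔-trans (+↔⊎ {M₂′}) (⊎-cong (↔-sym I₂) ↔-refl)))
    (↔-trans ⊎-shuffle
    (↔-trans (⊎-cong (⊎-cong (↔-sym Z↔X⊎Y) ↔-refl) ↔-refl)
    (↔-trans (⊎-cong I₁ ↔-refl) (↔-sym (+↔⊎ {M₁′}))))))
    value
  where
  open ≡-Reasoning
  value : toℚ₊ (M₁′ ℕ.+ M₂) ℚ.- toℚ₊ (M₂′ ℕ.+ M₁) ≡ a ℚ.- b
  value = begin
    toℚ₊ (M₁′ ℕ.+ M₂) ℚ.- toℚ₊ (M₂′ ℕ.+ M₁)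
      ≡⟨ cong₂ ℚ._-_ (toℚ₊-+ M₁′ M₂) (toℚ₊-+ M₂′ M₁) ⟩
    (toℚ₊ M₁′ ℚ.+ toℚ₊ M₂) ℚ.- (toℚ₊ M₂′ ℚ.+ toℚ₊ M₁)
      ≡⟨ solve 4 (λ a b c e → (a :+ b) :- (c :+ e) := (a :- e) :- (c :- b)) refl
                 (toℚ₊ M₁′) (toℚ₊ M₂) (toℚ₊ M₂′) (toℚ₊ M₁) ⟩
    (toℚ₊ M₁′ ℚ.- toℚ₊ M₁) ℚ.- (toℚ₊ M₂′ ℚ.- toℚ₊ M₂)
      ≡⟨ cong₂ ℚ._-_ v₁ v₂ ⟩
    a ℚ.- b ∎

virtualCount-empty : ∀ {X z} → ¬ X → VirtualCount X z → z ≡ 0ℚ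
virtualCount-empty ¬x (virtualCount M M′ I v)
  with refl ← ↔⇒≡ (↔-trans (↔-sym (¬⇒⊎-identityˡ ¬x)) I) =
  trans (sym v) (ℚP.+-inverseʳ (toℚ₊ M))

Sol-≡ : ∀ {k} {B : Vec ℤ k} {b} {x y : Vec ℕ k} (p : dotℕ B x ≡ b) (q : dotℕ B y ≡ b) →
        x ≡ y → _≡_ {A = Sol B b} (x , p) (y , q)
Sol-≡ p q refl = cong (_ ,_) (UIP.Decidable⇒UIP.≡-irrelevant ℤ._≟_ p q)

dotℕ-zeroʳ : ∀ {k} (B : Vec ℤ k) → dotℕ B (replicate k 0) ≡ 0ℤ
dotℕ-zeroʳ []      = refl
dotℕ-zeroʳ (a ∷ B) = cong₂ ℤ._+_ (ℤP.*-zeroʳ a) (dotℕ-zeroʳ B)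

dotℕ-+ : ∀ {k} (B : Vec ℤ k) x y → dotℕ B (zipWith ℕ._+_ x y) ≡ dotℕ B x ℤ.+ dotℕ B y
dotℕ-+ []      []       []       = refl
dotℕ-+ (a ∷ B) (x ∷ xs) (y ∷ ys) = begin
  a ℤ.* + (x ℕ.+ y) ℤ.+ dotℕ B (zipWith ℕ._+_ xs ys)
    ≡⟨ cong₂ (λ s t → a ℤ.* s ℤ.+ t) (ℤP.pos-+ x y) (dotℕ-+ B xs ys) ⟩
  a ℤ.* (+ x ℤ.+ + y) ℤ.+ (dotℕ B xs ℤ.+ dotℕ B ys)
    ≡⟨ distrib a (+ x) (+ y) (dotℕ B xs) (dotℕ B ys) ⟩
  (a ℤ.* + x ℤ.+ dotℕ B xs) ℤ.+ (a ℤ.* + y ℤ.+ dotℕ B ys) ∎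
  where
  open ≡-Reasoning
  distrib : ∀ a x y r s → a ℤ.* (x ℤ.+ y) ℤ.+ (r ℤ.+ s) ≡ (a ℤ.* x ℤ.+ r) ℤ.+ (a ℤ.* y ℤ.+ s)
  distrib = solve-∀

dotℕ-zero : ∀ {k} d (R : Vec ℤ k) xs → dotℕ (d ∷ R) (0 ∷ xs) ≡ dotℕ R xs
dotℕ-zero d R xs = trans (cong (ℤ._+ dotℕ R xs) (ℤP.*-zeroʳ d)) (ℤP.+-identityˡ (dotℕ R xs))

dotℕ-suc : ∀ {k} d (R : Vec ℤ k) x xs → dotℕ (d ∷ R) (suc x ∷ xs) ≡ dotℕ (d ∷ R) (x ∷ xs) ℤ.+ d
dotℕ-suc d R x xs =
  trans (cong (λ t → d ℤ.* t ℤ.+ dotℕ R xs) (ℤP.pos-+ 1 x)) (shift d (+ x) (dotℕ R xs))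
  where
  shift : ∀ d x r → d ℤ.* (+ 1 ℤ.+ x) ℤ.+ r ≡ (d ℤ.* x ℤ.+ r) ℤ.+ d
  shift = solve-∀

dotℕ-swap : ∀ {k} a b (R : Vec ℤ k) x y xs →
            dotℕ (a ∷ b ∷ R) (x ∷ y ∷ xs) ≡ dotℕ (b ∷ a ∷ R) (y ∷ x ∷ xs)
dotℕ-swap a b R x y xs = swap (a ℤ.* + x) (b ℤ.* + y) (dotℕ R xs)
  where
  swap : ∀ u v r → u ℤ.+ (v ℤ.+ r) ≡ v ℤ.+ (u ℤ.+ r)
  swap = solve-∀

Sol-swap : ∀ {k} a b (R : Vec ℤ k) c → Sol (a ∷ b ∷ R) c ↔ Sol (b ∷ a ∷ R) c
Sol-swap a b R c = mk↔ₛ′ (swap a b) (swap b a) (swap-swap a b) (swap-swap b a)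
  where
  swap : ∀ a b → Sol (a ∷ b ∷ R) c → Sol (b ∷ a ∷ R) c
  swap a b (x ∷ y ∷ xs , e) = y ∷ x ∷ xs , trans (sym (dotℕ-swap a b R x y xs)) e
  swap-swap : ∀ a b s → swap a b (swap b a s) ≡ s
  swap-swap a b (x ∷ y ∷ xs , e) = Sol-≡ {B = b ∷ a ∷ R} _ _ refl

-- R′ is R without the entry d: a solution of R x = y + d has either a positive
-- d-coordinate (decrease it) or a zero one (drop it).
Splits : ∀ {k l} → Vec ℤ k → ℤ → Vec ℤ l → Set
Splits R d R′ = ∀ y → Sol R (y ℤ.+ d) ↔ (Sol R y ⊎ Sol R′ (y ℤ.+ d))

splits-head : ∀ {k} d (R : Vec ℤ k) → Splits (d ∷ R) d R
splits-head d R y = mk↔ₛ′ to from to∘from from∘to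
  where
  to : Sol (d ∷ R) (y ℤ.+ d) → Sol (d ∷ R) y ⊎ Sol R (y ℤ.+ d)
  to (zero  ∷ xs , e) = inj₂ (xs , trans (sym (dotℕ-zero d R xs)) e)
  to (suc x ∷ xs , e) = inj₁ (x ∷ xs , +-cancelʳ d _ _ (trans (sym (dotℕ-suc d R x xs)) e))
  from : Sol (d ∷ R) y ⊎ Sol R (y ℤ.+ d) → Sol (d ∷ R) (y ℤ.+ d)
  from (inj₁ (x ∷ xs , e)) = suc x ∷ xs , trans (dotℕ-suc d R x xs) (cong (ℤ._+ d) e)
  from (inj₂ (xs , e))     = zero ∷ xs , trans (dotℕ-zero d R xs) e
  to∘from : ∀ s → to (from s) ≡ s
  to∘from (inj₁ (x ∷ xs , e)) = cong inj₁ (Sol-≡ {B = d ∷ R} _ _ refl)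
  to∘from (inj₂ (xs , e))     = cong inj₂ (Sol-≡ {B = R} _ _ refl)
  from∘to : ∀ s → from (to s) ≡ s
  from∘to (zero  ∷ xs , e) = Sol-≡ {B = d ∷ R} _ _ refl
  from∘to (suc x ∷ xs , e) = Sol-≡ {B = d ∷ R} _ _ refl

splits-second : ∀ {k} a d (R : Vec ℤ k) → Splits (a ∷ d ∷ R) d (a ∷ R)
splits-second a d R y =
  ↔-trans (Sol-swap a d R _)
    (↔-trans (splits-head d (a ∷ R) y) (⊎-cong (↔-sym (Sol-swap a d R y)) ↔-refl))

InS-+ : ∀ {k} {B : Vec ℤ k} {a b} → InS B a → InS B b → InS B (a ℤ.+ b)
InS-+ {B = B} (x , refl) (y , refl) = zipWith ℕ._+_ x y , dotℕ-+ B x y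

InS-0 : ∀ {k} (B : Vec ℤ k) → InS B 0ℤ
InS-0 B = replicate _ 0 , dotℕ-zeroʳ B

InS-entries : ∀ {k} (B : Vec ℤ k) → All (InS B) B
InS-entries []      = []
InS-entries (a ∷ B) =
  (1 ∷ replicate _ 0 , trans (cong₂ ℤ._+_ (ℤP.*-identityʳ a) (dotℕ-zeroʳ B)) (ℤP.+-identityʳ a))
  ∷ All.map (λ { (x , e) → 0 ∷ x , trans (dotℕ-zero a B x) e })
            (InS-entries B)

InS-closed : ∀ {k} {B : Vec ℤ k} {c} → InS B c → All (λ d → InS B (c ℤ.+ d)) B
InS-closed {B = B} c∈S = All.map (InS-+ {B = B} c∈S) (InS-entries B)

Sol-[e]⇒∣ : ∀ {e y} → Sol (e ∷ []) y → e ∣ y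
Sol-[e]⇒∣ {e} (x ∷ [] , refl) = divides (+ x) (trans (ℤP.+-identityʳ _) (ℤP.*-comm e (+ x)))

[1+r]*d*L≢0 : ∀ r {d L} → d ≢ 0ℤ → L ≢ 0ℚ → toℚ₊ (suc r) ℚ.* toℚ d ℚ.* L ≢ 0ℚ
[1+r]*d*L≢0 r d≢0 L≢0 = p*q≢0 (p*q≢0 (toℚ₊-suc≢0 r) (toℚ≢0 d≢0)) L≢0

module _ (S : ℤ → Set) where

  Counts : ∀ {k} → Vec ℤ k → ℤ → (ℚ → ℚ) → Set
  Counts R σ f = ∀ {c} → S c → VirtualCount (Sol R (c ℤ.+ σ)) (f (toℚ c))

  Closed : ∀ {k} → Vec ℤ k → Set
  Closed R = ∀ {c} → S c → All (λ d → S (c ℤ.+ d)) R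

  Counts-Δ : ∀ {k l} {R : Vec ℤ k} {d} {R′ : Vec ℤ l} {σ f} → Splits R d R′ →
             (∀ {c} → S c → S (c ℤ.+ d)) → Counts R σ f → Counts R′ (σ ℤ.+ d) (Δ (toℚ d) f)
  Counts-Δ {R = R} {d} {R′} {σ} {f} splits closed counts {c} c∈S =
    subst₂ VirtualCount (cong (Sol R′) (ℤP.+-assoc c σ d))
      (cong (λ t → f t ℚ.- f (toℚ c)) (toℚ-+ c d))
      (virtualCount-split (splits (c ℤ.+ σ))
        (subst (λ t → VirtualCount (Sol R t) _) (shift c d σ) (counts (closed c∈S)))
        (counts c∈S))
    where
    shift : ∀ c d σ → c ℤ.+ d ℤ.+ σ ≡ c ℤ.+ σ ℤ.+ d
    shift = solve-∀

  -- Each Counts-Δ step deletes an entry other than the i-th; the one-entry system left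
  -- over has the nonzero constant count L, so it has solutions: its entry divides c + s.
  entry-divides-shifted : ∀ r (R : Vec ℤ (suc r)) i {σ f L} → HasLeading r f L → L ≢ 0ℚ →
                          All (_≢ 0ℤ) R → Closed R → Counts R σ f →
                          ∃ λ s → ∀ {c} → S c → lookup R i ∣ c ℤ.+ s
  entry-divides-shifted zero (e ∷ []) zero {σ} hf L≢0 _ _ counts = σ , e∣c+σ
    where
    e∣c+σ : ∀ {c} → S c → e ∣ c ℤ.+ σ
    e∣c+σ {c} c∈S with e ∣? (c ℤ.+ σ)
    ... | yes e∣ = e∣
    ... | no  e∤ = ⊥-elim (L≢0 (trans (sym (hf (toℚ c)))
                                 (virtualCount-empty (λ sol → e∤ (Sol-[e]⇒∣ sol)) (counts c∈S))))
  entry-divides-shifted (suc r) (d ∷ R) (suc i) {f = f} hf L≢0 (d≢0 ∷ R≢0) closed counts =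
    entry-divides-shifted r R i (hf (toℚ d)) ([1+r]*d*L≢0 r d≢0 L≢0) R≢0
      (λ c∈S → All.tail (closed c∈S))
      (Counts-Δ {R = d ∷ R} {R′ = R} {f = f} (splits-head d R)
        (λ c∈S → All.head (closed c∈S)) counts)
  entry-divides-shifted (suc r) (a ∷ d ∷ R) zero {f = f} hf L≢0 (a≢0 ∷ d≢0 ∷ R≢0) closed counts =
    entry-divides-shifted r (a ∷ R) zero (hf (toℚ d)) ([1+r]*d*L≢0 r d≢0 L≢0) (a≢0 ∷ R≢0)
      (λ c∈S → All-drop-second (closed c∈S))
      (Counts-Δ {R = a ∷ d ∷ R} {R′ = a ∷ R} {f = f} (splits-second a d R)
        (λ c∈S → All.head (All.tail (closed c∈S))) counts)

∣[S+s]⇒∣entries : ∀ {k} {B : Vec ℤ k} {d s} → (∀ {c} → InS B c → d ∣ c ℤ.+ s) → All (d ∣_) B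
∣[S+s]⇒∣entries {B = B} {d} {s} d∣c+s =
  All.map (λ b∈S → ∣m+n∣n⇒∣m (d∣c+s b∈S) d∣s) (InS-entries B)
  where
  d∣s : d ∣ s
  d∣s = subst (d ∣_) (ℤP.+-identityˡ s) (d∣c+s (InS-0 B))

entries-divide-entries : ∀ m (B : Vec ℤ (suc m)) → IsPolyOfDegreeOnS B m → All (_≢ 0ℤ) B →
                         ∀ i → All (lookup B i ∣_) B
entries-divide-entries m B (cs , last≢0 , values) B≢0 i =
  ∣[S+s]⇒∣entries (proj₂ (entry-divides-shifted (InS B) m B i (HasLeading-evalPoly m cs) last≢0 B≢0
                                                InS-closed counts))
  where
  counts : Counts (InS B) B 0ℤ (evalPoly cs)
  counts {c} c∈S =
    let n , count , eval = values c c∈S in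
    subst₂ VirtualCount (cong (Sol B) (sym (ℤP.+-identityʳ c))) (sym eval)
      (count⇒virtualCount count)

dotℚ-zeroʳ : ∀ {k} (B : Vec ℤ k) → dotℚ B (replicate k 0ℚ) ≡ 0ℚ
dotℚ-zeroʳ []      = refl
dotℚ-zeroʳ (a ∷ B) = cong₂ ℚ._+_ (ℚP.*-zeroʳ (toℚ a)) (dotℚ-zeroʳ B)

0≤replicate-0 : ∀ k → All (0ℚ ℚ.≤_) (replicate k 0ℚ)
0≤replicate-0 zero    = []
0≤replicate-0 (suc k) = ℚP.≤-refl ∷ 0≤replicate-0 k

PointedKernel-head≢0 : ∀ {k a} {B : Vec ℤ k} → PointedKernel (a ∷ B) → a ≢ 0ℤ
PointedKernel-head≢0 {B = B} pk refl =
  ℚP.1≢0 (All.head (pk (1ℚ ∷ replicate _ 0ℚ) (ℚP.nonNegative⁻¹ 1ℚ ∷ 0≤replicate-0 _)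
                       (cong (0ℚ ℚ.+_) (dotℚ-zeroʳ B))))

PointedKernel-tail : ∀ {k a} {B : Vec ℤ k} → PointedKernel (a ∷ B) → PointedKernel B
PointedKernel-tail {a = a} pk x 0≤x Bx≡0 =
  All.tail (pk (0ℚ ∷ x) (ℚP.≤-refl ∷ 0≤x) (cong₂ ℚ._+_ (ℚP.*-zeroʳ (toℚ a)) Bx≡0))

PointedKernel-drop-second : ∀ {k a b} {B : Vec ℤ k} →
                            PointedKernel (a ∷ b ∷ B) → PointedKernel (a ∷ B)
PointedKernel-drop-second {a = a} {b} {B} pk (u ∷ x) (0≤u ∷ 0≤x) e =
  All-drop-second (pk (u ∷ 0ℚ ∷ x) (0≤u ∷ ℚP.≤-refl ∷ 0≤x)
                      (trans (cong (toℚ a ℚ.* u ℚ.+_) b0+Bx≡Bx) e))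
  where
  b0+Bx≡Bx : toℚ b ℚ.* 0ℚ ℚ.+ dotℚ B x ≡ dotℚ B x
  b0+Bx≡Bx = trans (cong (ℚ._+ dotℚ B x) (ℚP.*-zeroʳ (toℚ b))) (ℚP.+-identityˡ (dotℚ B x))

PointedKernel-merge : ∀ {k a b} {B : Vec ℤ k} →
                      PointedKernel (a ∷ b ∷ B) → PointedKernel (a ℤ.+ b ∷ B)
PointedKernel-merge {a = a} {b} {B} pk (u ∷ x) (0≤u ∷ 0≤x) e =
  All-drop-second (pk (u ∷ u ∷ x) (0≤u ∷ 0≤u ∷ 0≤x) (trans merge e))
  where
  merge : toℚ a ℚ.* u ℚ.+ (toℚ b ℚ.* u ℚ.+ dotℚ B x) ≡ toℚ (a ℤ.+ b) ℚ.* u ℚ.+ dotℚ B x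
  merge = trans (solve 4 (λ a b u r → a :* u :+ (b :* u :+ r) := (a :+ b) :* u :+ r) refl
                         (toℚ a) (toℚ b) u (dotℚ B x))
                (cong (λ t → t ℚ.* u ℚ.+ dotℚ B x) (sym (toℚ-+ a b)))

PointedKernel⇒≢0 : ∀ {k} {B : Vec ℤ k} → PointedKernel B → All (_≢ 0ℤ) B
PointedKernel⇒≢0 {B = []}    pk = []
PointedKernel⇒≢0 {B = _ ∷ _} pk = PointedKernel-head≢0 pk ∷ PointedKernel⇒≢0 (PointedKernel-tail pk)

PointedKernel⇒head+≢0 : ∀ {k a} {B : Vec ℤ k} → PointedKernel (a ∷ B) → All (λ b → a ℤ.+ b ≢ 0ℤ) B
PointedKernel⇒head+≢0 {B = []}    pk = []
PointedKernel⇒head+≢0 {B = _ ∷ _} pk =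
  PointedKernel-head≢0 (PointedKernel-merge pk) ∷
  PointedKernel⇒head+≢0 (PointedKernel-drop-second pk)

∣i∣≡∣j∣∧i+j≢0⇒i≡j : ∀ i j → ℤ.∣ i ∣ ≡ ℤ.∣ j ∣ → i ℤ.+ j ≢ 0ℤ → i ≡ j
∣i∣≡∣j∣∧i+j≢0⇒i≡j (+ m)    (+ n)    eq   _      = cong +_ eq
∣i∣≡∣j∣∧i+j≢0⇒i≡j (+ m)    -[1+ n ] refl i+j≢0 = ⊥-elim (i+j≢0 (ℤP.+-inverseʳ (+ suc n)))
∣i∣≡∣j∣∧i+j≢0⇒i≡j -[1+ m ] (+ n)    refl i+j≢0 = ⊥-elim (i+j≢0 (ℤP.+-inverseˡ (+ suc m)))
∣i∣≡∣j∣∧i+j≢0⇒i≡j -[1+ m ] -[1+ n ] eq   _      = cong -[1+_] (ℕP.suc-injective eq)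

∣-antisym-+≢0 : ∀ {i j} → i ∣ j → j ∣ i → i ℤ.+ j ≢ 0ℤ → i ≡ j
∣-antisym-+≢0 i∣j j∣i = ∣i∣≡∣j∣∧i+j≢0⇒i≡j _ _ (ℕD.∣-antisym (∣⇒∣ᵤ i∣j) (∣⇒∣ᵤ j∣i))

PointedKernel∧IsPoly⇒constant : ∀ m (B : Vec ℤ (suc m)) → PointedKernel B → IsPolyOfDegreeOnS B m →
                                ∃ λ β → β ≢ 0ℤ × All (_≡ β) B
PointedKernel∧IsPoly⇒constant m (a ∷ R) pk isPoly =
  a , PointedKernel-head≢0 pk ,
  refl ∷ All.map (λ { (a∣b , b∣a , a+b≢0) → sym (∣-antisym-+≢0 a∣b b∣a a+b≢0) })
                 (All.zip (a∣R , All.zip (R∣a , PointedKernel⇒head+≢0 pk)))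
  where
  divides-all : ∀ i → All (lookup (a ∷ R) i ∣_) (a ∷ R)
  divides-all = entries-divide-entries m (a ∷ R) isPoly (PointedKernel⇒≢0 pk)
  a∣R : All (a ∣_) R
  a∣R = All.tail (divides-all zero)
  R∣a : All (_∣ a) R
  R∣a = All.tail (lookup⁻ (λ i → All.head (divides-all i)))

addToHead : ∀ {n} → ℚ → Vec ℚ (suc n) → Vec ℚ (suc n)
addToHead k (c ∷ cs) = k ℚ.+ c ∷ cs

evalPoly-addToHead : ∀ {n} k (cs : Vec ℚ (suc n)) x →
                     evalPoly (addToHead k cs) x ≡ k ℚ.+ evalPoly cs x
evalPoly-addToHead k (c ∷ cs) x = ℚP.+-assoc k c _

last-addToHead : ∀ {n} k (cs : Vec ℚ (suc (suc n))) → last (addToHead k cs) ≡ last cs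
last-addToHead k (c ∷ d ∷ ds) = refl

mulLinear : ∀ {n} → ℚ → ℚ → Vec ℚ (suc n) → Vec ℚ (suc (suc n))
mulLinear a b (c ∷ [])         = a ℚ.* c ∷ b ℚ.* c ∷ []
mulLinear a b (c ∷ cs@(_ ∷ _)) = a ℚ.* c ∷ addToHead (b ℚ.* c) (mulLinear a b cs)

evalPoly-mulLinear : ∀ {n} a b (cs : Vec ℚ (suc n)) x →
                     evalPoly (mulLinear a b cs) x ≡ (a ℚ.+ b ℚ.* x) ℚ.* evalPoly cs x
evalPoly-mulLinear a b (c ∷ []) x =
  solve 4 (λ a b c x → a :* c :+ x :* (b :* c :+ x :* con 0ℚ)
                      := (a :+ b :* x) :* (c :+ x :* con 0ℚ)) refl a b c x
evalPoly-mulLinear a b (c ∷ cs@(_ ∷ _)) x = begin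
  a ℚ.* c ℚ.+ x ℚ.* evalPoly (addToHead (b ℚ.* c) (mulLinear a b cs)) x
    ≡⟨ cong (λ t → a ℚ.* c ℚ.+ x ℚ.* t) (evalPoly-addToHead (b ℚ.* c) (mulLinear a b cs) x) ⟩
  a ℚ.* c ℚ.+ x ℚ.* (b ℚ.* c ℚ.+ evalPoly (mulLinear a b cs) x)
    ≡⟨ cong (λ t → a ℚ.* c ℚ.+ x ℚ.* (b ℚ.* c ℚ.+ t)) (evalPoly-mulLinear a b cs x) ⟩
  a ℚ.* c ℚ.+ x ℚ.* (b ℚ.* c ℚ.+ (a ℚ.+ b ℚ.* x) ℚ.* evalPoly cs x)
    ≡⟨ solve 5 (λ a b c x p → a :* c :+ x :* (b :* c :+ (a :+ b :* x) :* p)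
                             := (a :+ b :* x) :* (c :+ x :* p)) refl a b c x (evalPoly cs x) ⟩
  (a ℚ.+ b ℚ.* x) ℚ.* evalPoly (c ∷ cs) x ∎
  where open ≡-Reasoning

last-mulLinear : ∀ {n} a b (cs : Vec ℚ (suc n)) → last (mulLinear a b cs) ≡ b ℚ.* last cs
last-mulLinear a b (c ∷ [])         = refl
last-mulLinear a b (c ∷ cs@(_ ∷ _)) =
  trans (last-addToHead (b ℚ.* c) (mulLinear a b cs)) (last-mulLinear a b cs)

C*k!*[n∸k]!≡n! : ∀ {n k} → k ℕ.≤ n → (n C k) ℕ.* (k ! ℕ.* (n ℕ.∸ k) !) ≡ n !
C*k!*[n∸k]!≡n! {n} {k} k≤n =
  trans (cong (ℕ._* (k ! ℕ.* (n ℕ.∸ k) !)) (nCk≡n!/k![n-k]! k≤n))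
        (m/n*n≡m {{k ℕP.!* (n ℕ.∸ k) !≢0}} (k![n∸k]!∣n! k≤n))

-- Both sides times m! q! equal (q + m + 1)!.
suc-*-C : ∀ m q → suc m ℕ.* ((q ℕ.+ suc m) C suc m) ≡ (suc m ℕ.+ q) ℕ.* ((q ℕ.+ m) C m)
suc-*-C m q = ℕP.*-cancelʳ-≡ _ _ (m ! ℕ.* q !) {{m ℕP.!* q !≢0}} (begin
  suc m ℕ.* Y ℕ.* (m ! ℕ.* q !)                   ≡⟨ regroup (suc m) Y (m !) (q !) ⟩
  Y ℕ.* (suc m ! ℕ.* q !)
    ≡⟨ cong (λ t → Y ℕ.* (suc m ! ℕ.* t !)) (ℕP.m+n∸n≡m q (suc m)) ⟨
  Y ℕ.* (suc m ! ℕ.* (q ℕ.+ suc m ℕ.∸ suc m) !)   ≡⟨ C*k!*[n∸k]!≡n! (ℕP.m≤n+m (suc m) q) ⟩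
  (q ℕ.+ suc m) !                                 ≡⟨ cong _! (ℕP.+-suc q m) ⟩
  suc (q ℕ.+ m) ℕ.* (q ℕ.+ m) !
    ≡⟨ cong (suc (q ℕ.+ m) ℕ.*_) (C*k!*[n∸k]!≡n! (ℕP.m≤n+m m q)) ⟨
  suc (q ℕ.+ m) ℕ.* (X ℕ.* (m ! ℕ.* (q ℕ.+ m ℕ.∸ m) !))
    ≡⟨ cong (λ t → suc (q ℕ.+ m) ℕ.* (X ℕ.* (m ! ℕ.* t !))) (ℕP.m+n∸n≡m q m) ⟩
  suc (q ℕ.+ m) ℕ.* (X ℕ.* (m ! ℕ.* q !))         ≡⟨ reorder q m X (m ! ℕ.* q !) ⟩
  (suc m ℕ.+ q) ℕ.* X ℕ.* (m ! ℕ.* q !)           ∎)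
  where
  open ≡-Reasoning
  X : ℕ
  X = (q ℕ.+ m) C m
  Y : ℕ
  Y = (q ℕ.+ suc m) C suc m
  regroup : ∀ s y a b → s ℕ.* y ℕ.* (a ℕ.* b) ≡ y ℕ.* (s ℕ.* a ℕ.* b)
  regroup = ℕ-solve-∀
  reorder : ∀ q m x z → suc (q ℕ.+ m) ℕ.* (x ℕ.* z) ≡ (suc m ℕ.+ q) ℕ.* x ℕ.* z
  reorder = ℕ-solve-∀

Fin1↔ : ∀ {X : Set} (x : X) → (∀ y → x ≡ y) → Fin 1 ↔ X
Fin1↔ x x≡ = mk↔ₛ′ (λ _ → x) (λ _ → zero) x≡ λ { zero → refl }

dotℕ-constant : ∀ {k β} {B : Vec ℤ k} → All (_≡ β) B → ∀ x → dotℕ B x ≡ β ℤ.* + sum x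
dotℕ-constant {β = β} []         []       = sym (ℤP.*-zeroʳ β)
dotℕ-constant {β = β} {B = _ ∷ B} (refl ∷ B≡β) (x ∷ xs) = begin
  β ℤ.* + x ℤ.+ dotℕ B xs        ≡⟨ cong (λ t → β ℤ.* + x ℤ.+ t) (dotℕ-constant B≡β xs) ⟩
  β ℤ.* + x ℤ.+ β ℤ.* + sum xs   ≡⟨ ℤP.*-distribˡ-+ β (+ x) (+ sum xs) ⟨
  β ℤ.* (+ x ℤ.+ + sum xs)       ≡⟨ cong (β ℤ.*_) (ℤP.pos-+ x (sum xs)) ⟨
  β ℤ.* + (x ℕ.+ sum xs)         ∎
  where open ≡-Reasoning

sum≡0⇒≡replicate-0 : ∀ {k} (x : Vec ℕ k) → sum x ≡ 0 → x ≡ replicate k 0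
sum≡0⇒≡replicate-0 []         _   = refl
sum≡0⇒≡replicate-0 (0 ∷ xs) sum≡0 = cong (0 ∷_) (sum≡0⇒≡replicate-0 xs sum≡0)

module _ {β : ℤ} (β≢0 : β ≢ 0ℤ) where

  private instance
    β-nonZero = ℤ.≢-nonZero β≢0

  HasCount-single : ∀ q → HasCount (β ∷ []) (β ℤ.* + q) 1
  HasCount-single q = Fin1↔ (q ∷ [] , ℤP.+-identityʳ (β ℤ.* + q)) unique
    where
    unique : ∀ s → (q ∷ [] , _) ≡ s
    unique (x ∷ [] , βx+0≡βq) =
      Sol-≡ {B = β ∷ []} _ _ (cong (_∷ []) (sym (ℤP.+-injective
        (ℤP.*-cancelˡ-≡ β (+ x) (+ q) (trans (sym (ℤP.+-identityʳ _)) βx+0≡βq)))))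

  HasCount-zero : ∀ {k} {B : Vec ℤ k} → All (_≡ β) B → HasCount B 0ℤ 1
  HasCount-zero {k} {B} B≡β = Fin1↔ (replicate k 0 , dotℕ-zeroʳ B) unique
    where
    unique : ∀ s → (replicate k 0 , _) ≡ s
    unique (x , Bx≡0) = Sol-≡ {B = B} _ _ (sym (sum≡0⇒≡replicate-0 x sum≡0))
      where
      β*sum≡β*0 : β ℤ.* + sum x ≡ β ℤ.* + 0
      β*sum≡β*0 = trans (sym (dotℕ-constant B≡β x)) (trans Bx≡0 (sym (ℤP.*-zeroʳ β)))
      sum≡0 : sum x ≡ 0
      sum≡0 = ℤP.+-injective (ℤP.*-cancelˡ-≡ β _ _ β*sum≡β*0)

  -- Pascal's rule, via splits-head.
  HasCount-constant : ∀ m q (B : Vec ℤ (suc m)) → All (_≡ β) B →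
                      HasCount B (β ℤ.* + q) ((q ℕ.+ m) C m)
  HasCount-constant zero    q       (_ ∷ []) (refl ∷ []) = HasCount-single q
  HasCount-constant (suc m) zero    B         B≡β =
    subst₂ (HasCount B) (sym (ℤP.*-zeroʳ β)) (sym (nCn≡1 (suc m))) (HasCount-zero B≡β)
  HasCount-constant (suc m) (suc q) (_ ∷ R)  (refl ∷ R≡β) =
    subst₂ (λ n y → Fin n ↔ Sol (β ∷ R) y) (pascal q m) βq+β≡β[1+q]
      (↔-trans (+↔⊎ {(q ℕ.+ suc m) C suc m})
        (↔-trans (⊎-cong (HasCount-constant (suc m) q (β ∷ R) (refl ∷ R≡β))
                         (subst (λ y → Fin _ ↔ Sol R y) (sym βq+β≡β[1+q])
                                (HasCount-constant m (suc q) R R≡β)))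
                 (↔-sym (splits-head β R (β ℤ.* + q)))))
    where
    βq+β≡β[1+q] : β ℤ.* + q ℤ.+ β ≡ β ℤ.* + suc q
    βq+β≡β[1+q] = trans (distrib β (+ q)) (cong (β ℤ.*_) (sym (ℤP.pos-+ 1 q)))
      where
      distrib : ∀ b x → b ℤ.* x ℤ.+ b ≡ b ℤ.* (+ 1 ℤ.+ x)
      distrib = solve-∀
    pascal : ∀ q m → (q ℕ.+ suc m) C suc m ℕ.+ (suc q ℕ.+ m) C m ≡ (suc q ℕ.+ suc m) C suc m
    pascal q m rewrite ℕP.+-suc q m =
      trans (ℕP.+-comm ((suc (q ℕ.+ m)) C suc m) _) (nCk+nC[k+1]≡[n+1]C[k+1] (suc (q ℕ.+ m)) m)

  scale : ℕ → ℚ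
  scale m = toℚ β ℚ.* toℚ₊ (suc m)

  scale≢0 : ∀ m → scale m ≢ 0ℚ
  scale≢0 m = p*q≢0 (toℚ≢0 β≢0) (toℚ₊-suc≢0 m)

  scale⁻¹ : ℕ → ℚ
  scale⁻¹ m = ℚ.1/_ (scale m) {{ℚ.≢-nonZero (scale≢0 m)}}

  scale⁻¹*scale≡1 : ∀ m → scale⁻¹ m ℚ.* scale m ≡ 1ℚ
  scale⁻¹*scale≡1 m = ℚP.*-inverseˡ (scale m) {{ℚ.≢-nonZero (scale≢0 m)}}

  -- The coefficients of ∏ (1 + x / (β i)) over 1 ≤ i ≤ m.
  binomialPoly : ∀ m → Vec ℚ (suc m)
  binomialPoly zero    = 1ℚ ∷ []
  binomialPoly (suc m) = mulLinear 1ℚ (scale⁻¹ m) (binomialPoly m)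

  last-binomialPoly≢0 : ∀ m → last (binomialPoly m) ≢ 0ℚ
  last-binomialPoly≢0 zero    = ℚP.1≢0
  last-binomialPoly≢0 (suc m) last≡0 =
    p*q≢0 {scale⁻¹ m} (p*q≡1⇒p≢0 (scale⁻¹*scale≡1 m)) (last-binomialPoly≢0 m)
          (trans (sym (last-mulLinear 1ℚ (scale⁻¹ m) (binomialPoly m))) last≡0)

  evalPoly-binomialPoly : ∀ m q → evalPoly (binomialPoly m) (toℚ (β ℤ.* + q)) ≡ toℚ₊ ((q ℕ.+ m) C m)
  evalPoly-binomialPoly zero    q =
    solve 1 (λ x → con 1ℚ :+ x :* con 0ℚ := con 1ℚ) refl (toℚ (β ℤ.* + q))
  evalPoly-binomialPoly (suc m) q = begin
    evalPoly (mulLinear 1ℚ u (binomialPoly m)) (toℚ (β ℤ.* + q))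
      ≡⟨ evalPoly-mulLinear 1ℚ u (binomialPoly m) (toℚ (β ℤ.* + q)) ⟩
    (1ℚ ℚ.+ u ℚ.* toℚ (β ℤ.* + q)) ℚ.* evalPoly (binomialPoly m) (toℚ (β ℤ.* + q))
      ≡⟨ cong₂ (λ y z → (1ℚ ℚ.+ u ℚ.* y) ℚ.* z) (toℚ-* β (+ q)) (evalPoly-binomialPoly m q) ⟩
    (1ℚ ℚ.+ u ℚ.* (b ℚ.* toℚ₊ q)) ℚ.* X
      ≡⟨ cong (λ t → (t ℚ.+ u ℚ.* (b ℚ.* toℚ₊ q)) ℚ.* X) (scale⁻¹*scale≡1 m) ⟨
    (u ℚ.* (b ℚ.* toℚ₊ (suc m)) ℚ.+ u ℚ.* (b ℚ.* toℚ₊ q)) ℚ.* X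
      ≡⟨ solve 5 (λ u b s n X → (u :* (b :* s) :+ u :* (b :* n)) :* X
                                := u :* b :* ((s :+ n) :* X)) refl u b (toℚ₊ (suc m)) (toℚ₊ q) X ⟩
    u ℚ.* b ℚ.* ((toℚ₊ (suc m) ℚ.+ toℚ₊ q) ℚ.* X)
      ≡⟨ cong (u ℚ.* b ℚ.*_) absorption ⟩
    u ℚ.* b ℚ.* (toℚ₊ (suc m) ℚ.* Y)
      ≡⟨ solve 4 (λ u b s Y → u :* b :* (s :* Y) := u :* (b :* s) :* Y)
               refl u b (toℚ₊ (suc m)) Y ⟩
    u ℚ.* scale m ℚ.* Y
      ≡⟨ cong (ℚ._* Y) (scale⁻¹*scale≡1 m) ⟩
    1ℚ ℚ.* Y
      ≡⟨ ℚP.*-identityˡ Y ⟩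
    Y ∎
    where
    open ≡-Reasoning
    u : ℚ
    u = scale⁻¹ m
    b : ℚ
    b = toℚ β
    X : ℚ
    X = toℚ₊ ((q ℕ.+ m) C m)
    Y : ℚ
    Y = toℚ₊ ((q ℕ.+ suc m) C suc m)
    absorption : (toℚ₊ (suc m) ℚ.+ toℚ₊ q) ℚ.* X ≡ toℚ₊ (suc m) ℚ.* Y
    absorption = begin
      (toℚ₊ (suc m) ℚ.+ toℚ₊ q) ℚ.* X               ≡⟨ cong (ℚ._* X) (toℚ₊-+ (suc m) q) ⟨
      toℚ₊ (suc m ℕ.+ q) ℚ.* X                      ≡⟨ toℚ₊-* (suc m ℕ.+ q) ((q ℕ.+ m) C m) ⟨
      toℚ₊ ((suc m ℕ.+ q) ℕ.* ((q ℕ.+ m) C m))      ≡⟨ cong toℚ₊ (suc-*-C m q) ⟨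
      toℚ₊ (suc m ℕ.* ((q ℕ.+ suc m) C suc m))      ≡⟨ toℚ₊-* (suc m) ((q ℕ.+ suc m) C suc m) ⟩
      toℚ₊ (suc m) ℚ.* Y                            ∎

  constant⇒HasCount : ∀ m (B : Vec ℤ (suc m)) → All (_≡ β) B → ∀ b → InS B b →
               ∃ λ q → b ≡ β ℤ.* + q × HasCount B b ((q ℕ.+ m) C m)
  constant⇒HasCount m B B≡β b (x , refl) =
    sum x , dotℕ-constant B≡β x ,
    subst (λ y → HasCount B y _) (sym (dotℕ-constant B≡β x)) (HasCount-constant m (sum x) B B≡β)

  constant⇒IsPoly : ∀ m (B : Vec ℤ (suc m)) → All (_≡ β) B → IsPolyOfDegreeOnS B m
  constant⇒IsPoly m B B≡β = binomialPoly m , last-binomialPoly≢0 m , values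
    where
    values : ∀ b → InS B b → ∃ λ n → HasCount B b n × evalPoly (binomialPoly m) (toℚ b) ≡ toℚ₊ n
    values b b∈S =
      let q , b≡βq , count = constant⇒HasCount m B B≡β b b∈S in
      (q ℕ.+ m) C m , count ,
      trans (cong (λ c → evalPoly (binomialPoly m) (toℚ c)) b≡βq) (evalPoly-binomialPoly m q)

lemma5p3 : (m : ℕ) (B : Vec ℤ (suc m)) → PointedKernel B →
    (IsPolyOfDegreeOnS B m ⇔ (∃ λ (β : ℤ) → β ≢ + 0 × All (_≡ β) B))
    × ((β : ℤ) → β ≢ + 0 → All (_≡ β) B →
    (b : ℤ) → InS B b →
    ∃ λ (q : ℕ) → b ≡ β * + q × HasCount B b ((q + m) C m))
lemma5p3 m B pk =
  mk⇔ (PointedKernel∧IsPoly⇒constant m B pk)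
      (λ { (β , β≢0 , B≡β) → constant⇒IsPoly β≢0 m B B≡β }) ,
  λ β β≢0 B≡β → constant⇒HasCount β≢0 m B B≡β
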